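{- Let $A$ be a modal formula. (1) If $\mathbf{N4} \vdash A$, then $A$ is valid in all transitive $\mathbf{N}$-frames. (2) If $\mathbf{NR4} \vdash A$, then $A$ is valid in all transitive and serial $\mathbf{N}$-frames.
   Context: Modal formulas are built from propositional variables and $\bot$ using $\neg,\land,\lor,\to$ and $\Box$. $\mathbf{N}$ has all propositional tautologies as axioms and Modus Ponens and Necessitation $A/\Box A$ as rules; $\mathbf{NR}$ is $\mathbf{N}$ plus the rule $\neg B/\neg\Box B$; $\mathbf{N4}$ and $\mathbf{NR4}$ are $\mathbf{N}$ and $\mathbf{NR}$ plus the axiom scheme $\Box B\to\Box\Box B$. An $\mathbf{N}$-frame is $(W, \{\prec_B\}_B)$ with $W$ nonempty and a binary relation $\prec_B$ on $W$ for each modal formula $B$; an $\mathbf{N}$-model adds $\Vdash$ with usual propositional clauses and $x\Vdash\Box B$ iff $y\Vdash B$ for all $y$ with $x\prec_B y$. Validity in a frame means truth at all worlds of all models on the frame. The frame is serial if for every $B$ and $x$ there is $y$ with $x\prec_B y$; it is transitive if for every modal formula $B$ and all $x,y,z$, $x\prec_{\Box B} y$ and $y\prec_B z$ imply $x\prec_B z$. -}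

module Defs where

open import Data.Nat using (ℕ)
open import Data.Bool using (Bool; true; false; not; _∧_; _∨_)
open import Data.Product using (_×_; Σ)
open import Data.Empty using (⊥)
open import Relation.Nullary using (¬_)
open import Relation.Binary.PropositionalEquality using (_≡_)
open import Level using (Level; _⊔_) renaming (suc to lsuc)

infixr 4 _⇒_
infixr 5 _∨'_
infixr 6 _∧'_
data Fm : Set where
  var  : ℕ → Fm
  ⊥'   : Fm
  ¬'_  : Fm → Fm
  _∧'_ : Fm → Fm → Fm
  _∨'_ : Fm → Fm → Fm
  _⇒_  : Fm → Fm → Fm
  □_   : Fm → Fm

evalB : (ℕ → Bool) → (Fm → Bool) → Fm → Bool
evalB v b (var p) = v p
evalB v b ⊥' = false
evalB v b (¬' A) = not (evalB v b A)
evalB v b (A ∧' B) = evalB v b A ∧ evalB v b B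
evalB v b (A ∨' B) = evalB v b A ∨ evalB v b B
evalB v b (A ⇒ B) = not (evalB v b A) ∨ evalB v b B
evalB v b (□ A) = b A

-- A is a propositional tautology (substitution instance of one)
Tautology : Fm → Set
Tautology A = ∀ (v : ℕ → Bool) (b : Fm → Bool) → evalB v b A ≡ true

-- Derivability in N / NR / N4 / NR4
-- r : rule ¬B/¬□B available;  t : axiom □B → □□B available
data ⊢[_,_] (r t : Bool) : Fm → Set where
  taut : ∀ {A} → Tautology A → ⊢[ r , t ] A
  mp   : ∀ {A B} → ⊢[ r , t ] (A ⇒ B) → ⊢[ r , t ] A → ⊢[ r , t ] B
  nec  : ∀ {A} → ⊢[ r , t ] A → ⊢[ r , t ] (□ A)
  ruleR : ∀ {B} → r ≡ true → ⊢[ r , t ] (¬' B) → ⊢[ r , t ] (¬' (□ B))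
  ax4  : ∀ {B} → t ≡ true → ⊢[ r , t ] ((□ B) ⇒ (□ (□ B)))

N4⊢_ : Fm → Set
N4⊢ A = ⊢[ false , true ] A

NR4⊢_ : Fm → Set
NR4⊢ A = ⊢[ true , true ] A

record NFrame (ℓ : Level) : Set (lsuc ℓ) where
  field
    W    : Set ℓ
    w₀   : W                       -- nonemptiness
    R    : Fm → W → W → Set ℓ

module _ {ℓ : Level} (F : NFrame ℓ) where
  open NFrame F

  -- Forcing (classical semantics; all clauses are ¬¬-stable,
  -- valuations are Boolean-valued so atoms are decidable)
  _,_⊩_ : (ℕ → W → Bool) → W → Fm → Set ℓ
  V , x ⊩ var p = Level.Lift _ (V p x ≡ true)
  V , x ⊩ ⊥' = Level.Lift _ ⊥
  V , x ⊩ (¬' A) = ¬ (V , x ⊩ A)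
  V , x ⊩ (A ∧' B) = (V , x ⊩ A) × (V , x ⊩ B)
  V , x ⊩ (A ∨' B) = ¬ (¬ (V , x ⊩ A) × ¬ (V , x ⊩ B))
  V , x ⊩ (A ⇒ B) = (V , x ⊩ A) → (V , x ⊩ B)
  V , x ⊩ (□ A) = ∀ y → R A x y → V , y ⊩ A

  ValidIn : Fm → Set ℓ
  ValidIn A = ∀ (V : ℕ → W → Bool) (x : W) → V , x ⊩ A

  Serial : Set ℓ
  Serial = ∀ (B : Fm) (x : W) → Σ W (λ y → R B x y)

  Transitive : Set ℓ
  Transitive = ∀ (B : Fm) (x y z : W) → R (□ B) x y → R B y z → R B x z

-- A tautology holds at a world x once each boxed subformula □B is read as the
-- atom "x forces □B": such a Boolean reading exists up to double negation, and
-- forcing is ¬¬-stable. Necessitation and modus ponens preserve validity in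
-- every N-frame; transitivity of the frame validates □B → □□B, and seriality
-- makes the rule ¬B/¬□B sound, since ¬□B at x is witnessed by a ≺_B-successor.
module Submission where

open import Defs
open import Data.Bool using (Bool; true; false; _∨_; if_then_else_)
open import Data.List using (List; []; _∷_; _++_)
open import Data.List.Relation.Unary.All as All using (All; []; _∷_)
open import Data.List.Relation.Unary.All.Properties using (++⁻)
open import Data.Nat using (ℕ)
import Data.Nat.Properties as ℕ
open import Data.Product using (Σ; _×_; _,_; proj₁; proj₂; uncurry)
open import Function using (const)
open import Level using (Level; Lift; lift; 0ℓ; _⊔_)
open import Relation.Binary.Definitions using (DecidableEquality)
open import Relation.Binary.PropositionalEquality using (_≡_; _≢_; refl; cong; cong₂; subst)
open import Relation.Nullary.Decidable using (yes; no; does; proof; map′; _×-dec_; ¬¬-excluded-middle)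
open import Relation.Nullary.Negation using (¬_; Stable; contradiction; ¬¬-map)
open import Relation.Nullary.Reflects using (Reflects; ofʸ; ofⁿ; of; invert; ¬-reflects; _×-reflects_; _→-reflects_)

private
  variable
    a ℓ : Level

infix 4 _≟_
_≟_ : DecidableEquality Fm
var p ≟ var q = map′ (cong var) (λ { refl → refl }) (p ℕ.≟ q)
⊥' ≟ ⊥' = yes refl
(¬' A) ≟ (¬' B) = map′ (cong ¬'_) (λ { refl → refl }) (A ≟ B)
(A ∧' B) ≟ (C ∧' D) = map′ (uncurry (cong₂ _∧'_)) (λ { refl → refl , refl }) (A ≟ C ×-dec B ≟ D)
(A ∨' B) ≟ (C ∨' D) = map′ (uncurry (cong₂ _∨'_)) (λ { refl → refl , refl }) (A ≟ C ×-dec B ≟ D)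
(A ⇒ B) ≟ (C ⇒ D) = map′ (uncurry (cong₂ _⇒_)) (λ { refl → refl , refl }) (A ≟ C ×-dec B ≟ D)
(□ A) ≟ (□ B) = map′ (cong □_) (λ { refl → refl }) (A ≟ B)
var _ ≟ ⊥' = no λ ()
var _ ≟ (¬' _) = no λ ()
var _ ≟ (_ ∧' _) = no λ ()
var _ ≟ (_ ∨' _) = no λ ()
var _ ≟ (_ ⇒ _) = no λ ()
var _ ≟ (□ _) = no λ ()
⊥' ≟ var _ = no λ ()
⊥' ≟ (¬' _) = no λ ()
⊥' ≟ (_ ∧' _) = no λ ()
⊥' ≟ (_ ∨' _) = no λ ()
⊥' ≟ (_ ⇒ _) = no λ ()
⊥' ≟ (□ _) = no λ ()
(¬' _) ≟ var _ = no λ ()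
(¬' _) ≟ ⊥' = no λ ()
(¬' _) ≟ (_ ∧' _) = no λ ()
(¬' _) ≟ (_ ∨' _) = no λ ()
(¬' _) ≟ (_ ⇒ _) = no λ ()
(¬' _) ≟ (□ _) = no λ ()
(_ ∧' _) ≟ var _ = no λ ()
(_ ∧' _) ≟ ⊥' = no λ ()
(_ ∧' _) ≟ (¬' _) = no λ ()
(_ ∧' _) ≟ (_ ∨' _) = no λ ()
(_ ∧' _) ≟ (_ ⇒ _) = no λ ()
(_ ∧' _) ≟ (□ _) = no λ ()
(_ ∨' _) ≟ var _ = no λ ()
(_ ∨' _) ≟ ⊥' = no λ ()
(_ ∨' _) ≟ (¬' _) = no λ ()
(_ ∨' _) ≟ (_ ∧' _) = no λ ()
(_ ∨' _) ≟ (_ ⇒ _) = no λ ()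
(_ ∨' _) ≟ (□ _) = no λ ()
(_ ⇒ _) ≟ var _ = no λ ()
(_ ⇒ _) ≟ ⊥' = no λ ()
(_ ⇒ _) ≟ (¬' _) = no λ ()
(_ ⇒ _) ≟ (_ ∧' _) = no λ ()
(_ ⇒ _) ≟ (_ ∨' _) = no λ ()
(_ ⇒ _) ≟ (□ _) = no λ ()
(□ _) ≟ var _ = no λ ()
(□ _) ≟ ⊥' = no λ ()
(□ _) ≟ (¬' _) = no λ ()
(□ _) ≟ (_ ∧' _) = no λ ()
(□ _) ≟ (_ ∨' _) = no λ ()
(□ _) ≟ (_ ⇒ _) = no λ ()

boxes : Fm → List Fm
boxes (var _) = []
boxes ⊥' = []
boxes (¬' A) = boxes A
boxes (A ∧' B) = boxes A ++ boxes B
boxes (A ∨' B) = boxes A ++ boxes B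
boxes (A ⇒ B) = boxes A ++ boxes B
boxes (□ A) = A ∷ []

module _ {A : Set a} (_≟ᴬ_ : DecidableEquality A) (P : A → Set ℓ) where

  Reflecting : (A → Bool) → List A → Set (a ⊔ ℓ)
  Reflecting b = All (λ x → Reflects (P x) (b x))

  _[_↦_] : (A → Bool) → A → Bool → A → Bool
  (b [ x ↦ c ]) y = if does (y ≟ᴬ x) then c else b y

  update-reflects : ∀ {b x c} y → Reflects (P x) c → (y ≢ x → Reflects (P y) (b y)) →
                    Reflects (P y) ((b [ x ↦ c ]) y)
  update-reflects {x = x} y rx ry with y ≟ᴬ x
  ... | yes refl = rx
  ... | no y≢x = ry y≢x

  ¬¬-reflecting : ∀ xs → ¬ ¬ Σ (A → Bool) (λ b → Reflecting b xs)
  ¬¬-reflecting [] k = k (const true , [])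
  ¬¬-reflecting (x ∷ xs) k = ¬¬-reflecting xs λ (b , bs) → ¬¬-excluded-middle λ Px? →
    k ( b [ x ↦ does Px? ]
      , update-reflects {b = b} x (proof Px?) (contradiction refl)
      ∷ All.map (λ {y} r → update-reflects {b = b} y (proof Px?) (const r)) bs)

lift-≡true-reflects : ∀ c → Reflects (Lift ℓ (c ≡ true)) c
lift-≡true-reflects true = of (lift refl)
lift-≡true-reflects false = of λ { (lift ()) }

infixr 1 _¬¬⊎-reflects_
_¬¬⊎-reflects_ : {P Q : Set ℓ} {c d : Bool} → Reflects P c → Reflects Q d →
                 Reflects (¬ (¬ P × ¬ Q)) (c ∨ d)
ofʸ p ¬¬⊎-reflects _ = of λ (¬p , _) → ¬p p
ofⁿ _ ¬¬⊎-reflects ofʸ q = of λ (_ , ¬q) → ¬q q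
ofⁿ ¬p ¬¬⊎-reflects ofⁿ ¬q = of λ k → k (¬p , ¬q)

module _ (F : NFrame ℓ) where
  open NFrame F

  infix 3 _,_⊩ᶠ_
  _,_⊩ᶠ_ : (ℕ → W → Bool) → W → Fm → Set ℓ
  _,_⊩ᶠ_ = _,_⊩_ F

  module _ (V : ℕ → W → Bool) where

    ⊩-stable : ∀ x A → Stable (V , x ⊩ᶠ A)
    ⊩-stable x (var p) ¬¬Vp with V p x
    ... | true = lift refl
    ... | false = contradiction (λ { (lift ()) }) ¬¬Vp
    ⊩-stable x ⊥' ¬¬⊥ = contradiction (λ { (lift ()) }) ¬¬⊥
    ⊩-stable x (¬' A) ¬¬¬A ⊩A = ¬¬¬A (λ ¬A → ¬A ⊩A)
    ⊩-stable x (A ∧' B) ¬¬A∧B = ⊩-stable x A (¬¬-map proj₁ ¬¬A∧B) , ⊩-stable x B (¬¬-map proj₂ ¬¬A∧B)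
    ⊩-stable x (A ∨' B) ¬¬A∨B ¬A×¬B = ¬¬A∨B (λ A∨B → A∨B ¬A×¬B)
    ⊩-stable x (A ⇒ B) ¬¬A⇒B ⊩A = ⊩-stable x B (¬¬-map (λ A⇒B → A⇒B ⊩A) ¬¬A⇒B)
    ⊩-stable x (□ A) ¬¬□A y x≺y = ⊩-stable y A (¬¬-map (λ □A → □A y x≺y) ¬¬□A)

    ReflectsBoxesAt : W → (Fm → Bool) → List Fm → Set ℓ
    ReflectsBoxesAt x = Reflecting _≟_ (λ B → V , x ⊩ᶠ □ B)

    evalB-reflects-⊩ : ∀ {x b} A → ReflectsBoxesAt x b (boxes A) →
                       Reflects (V , x ⊩ᶠ A) (evalB (λ p → V p x) b A)
    evalB-reflects-⊩ {x} (var p) _ = lift-≡true-reflects (V p x)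
    evalB-reflects-⊩ ⊥' _ = of λ { (lift ()) }
    evalB-reflects-⊩ (¬' A) bs = ¬-reflects (evalB-reflects-⊩ A bs)
    evalB-reflects-⊩ (A ∧' B) bs =
      let bsA , bsB = ++⁻ (boxes A) bs in evalB-reflects-⊩ A bsA ×-reflects evalB-reflects-⊩ B bsB
    evalB-reflects-⊩ (A ∨' B) bs =
      let bsA , bsB = ++⁻ (boxes A) bs in evalB-reflects-⊩ A bsA ¬¬⊎-reflects evalB-reflects-⊩ B bsB
    evalB-reflects-⊩ (A ⇒ B) bs =
      let bsA , bsB = ++⁻ (boxes A) bs in evalB-reflects-⊩ A bsA →-reflects evalB-reflects-⊩ B bsB
    evalB-reflects-⊩ (□ A) (r ∷ []) = r

  tautology-valid : ∀ {A} → Tautology A → ValidIn F A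
  tautology-valid {A} tautA V x = ⊩-stable V x A (¬¬-map forced (¬¬-reflecting _≟_ _ (boxes A)))
    where
    forced : Σ (Fm → Bool) (λ b → ReflectsBoxesAt V x b (boxes A)) → V , x ⊩ᶠ A
    forced (b , bs) = invert (subst (Reflects _) (tautA (λ p → V p x) b) (evalB-reflects-⊩ V A bs))

  mp-valid : ∀ {A B} → ValidIn F (A ⇒ B) → ValidIn F A → ValidIn F B
  mp-valid ⊨A⇒B ⊨A V x = ⊨A⇒B V x (⊨A V x)

  nec-valid : ∀ {A} → ValidIn F A → ValidIn F (□ A)
  nec-valid ⊨A V _ y _ = ⊨A V y

  ruleR-valid : Serial F → ∀ {B} → ValidIn F (¬' B) → ValidIn F (¬' (□ B))
  ruleR-valid serial {B} ⊨¬B V x □B with serial B x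
  ... | y , x≺y = ⊨¬B V y (□B y x≺y)

  axiom4-valid : Transitive F → ∀ {B} → ValidIn F ((□ B) ⇒ (□ (□ B)))
  axiom4-valid transitive {B} V x □B y x≺y z y≺z = □B z (transitive B x y z x≺y y≺z)

  ⊢-sound : ∀ {r t A} → ⊢[ r , t ] A → (t ≡ true → Transitive F) → (r ≡ true → Serial F) → ValidIn F A
  ⊢-sound (taut t) _ _ = tautology-valid t
  ⊢-sound (mp ⊢A⇒B ⊢A) tr se = mp-valid (⊢-sound ⊢A⇒B tr se) (⊢-sound ⊢A tr se)
  ⊢-sound (nec ⊢A) tr se = nec-valid (⊢-sound ⊢A tr se)
  ⊢-sound (ruleR r≡true ⊢¬B) tr se = ruleR-valid (se r≡true) (⊢-sound ⊢¬B tr se)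
  ⊢-sound (ax4 t≡true) tr _ = axiom4-valid (tr t≡true)

corollary3p10 : (A : Fm) →
    ((N4⊢ A) → (F : NFrame 0ℓ) → Transitive F → ValidIn F A)
    × ((NR4⊢ A) → (F : NFrame 0ℓ) → Transitive F → Serial F → ValidIn F A)
corollary3p10 A =
    (λ ⊢A F transitive → ⊢-sound F ⊢A (const transitive) (λ ()))
  , (λ ⊢A F transitive serial → ⊢-sound F ⊢A (const transitive) (const serial))
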